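{- Fix $0<\kappa<1/3$ and $t\in\mathbb{N}$; let $d$ be sufficiently large in terms of $\kappa,t$ and $n$ sufficiently large in terms of $d$. Let $H$ be a graph with no subgraph isomorphic to $K_{t,t,t}$, with $n$ vertices, average degree $d$ and maximum degree $\Delta\le(1+\kappa)d$, and let $p=\kappa/d$. Let $A\subseteq V(H)$ be random, containing each vertex independently with probability $p$, and let $I$ be a maximum independent set of the induced subgraph $H[A]$. Then \[\Pr\big[|I|\le(1-2\kappa)np\big]=\exp\!\left(-\Omega\!\left(\frac{\kappa^4 n}{d^5}\right)\right).\]
   Context: The $\Omega(\cdot)$ hides a positive absolute constant. $K_{t,t,t}$ is the complete tripartite graph with parts of size $t$.
   Formalization: The parameter κ takes only rational values in the interval $0<\kappa<1/3$. -}

module Defs where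

open import Data.Bool using (Bool; true; false; _∧_; not; if_then_else_)
open import Data.Nat as ℕ using (ℕ; zero; suc)
open import Data.Integer using (+_)
open import Data.Rational using (ℚ; 0ℚ; 1ℚ; _+_; _*_; _-_; _≤ᵇ_; 1/_; Positive)
open import Data.Rational.Properties using (pos⇒nonZero)
open import Data.Fin using (Fin)
open import Data.Fin.Subset using (Subset; ∣_∣)
open import Data.Vec using (Vec; []; _∷_; tabulate; lookup; zipWith)
open import Data.List using (List; []; _∷_; _++_; map; foldr; filter; allFin)
import Data.List as List
open import Data.Product using (_×_; _,_)
open import Relation.Binary.PropositionalEquality using (_≡_; _≢_)
open import Relation.Nullary using (¬_)

ℕ→ℚ : ℕ → ℚ
ℕ→ℚ k = + k Data.Rational./ 1

_^ℚ_ : ℚ → ℕ → ℚ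
q ^ℚ zero = 1ℚ
q ^ℚ suc k = q * (q ^ℚ k)

record Graph (n : ℕ) : Set where
  field
    adj   : Fin n → Fin n → Bool
    sym   : ∀ u v → adj u v ≡ adj v u
    irrefl : ∀ v → adj v v ≡ false
open Graph public

deg : ∀ {n} → Graph n → Fin n → ℕ
deg H v = ∣ tabulate (adj H v) ∣

degSum : ∀ {n} → Graph n → ℕ
degSum {n} H = foldr ℕ._+_ 0 (map (deg H) (allFin n))

HasAvgDeg : ∀ {n} → Graph n → ℚ → Set
HasAvgDeg {n} H d = ℕ→ℚ (degSum H) ≡ d * ℕ→ℚ n

MaxDegLe : ∀ {n} → Graph n → ℚ → Set
MaxDegLe {n} H D = ∀ v → (ℕ→ℚ (deg H v) ≤ᵇ D) ≡ true

-- K_{t,t,t} as a subgraph: an injective map from the 3t vertices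
-- (part i ∈ Fin 3, index j ∈ Fin t) to V(H) such that vertices in
-- different parts are mapped to adjacent vertices.
ContainsKttt : ∀ {n} → Graph n → ℕ → Set
ContainsKttt {n} H t =
  Data.Product.Σ (Fin 3 → Fin t → Fin n) λ f →
    (∀ i j i′ j′ → f i j ≡ f i′ j′ → (i ≡ i′ × j ≡ j′)) ×
    (∀ i j i′ j′ → i ≢ i′ → adj H (f i j) (f i′ j′) ≡ true)

KtttFree : ∀ {n} → Graph n → ℕ → Set
KtttFree H t = ¬ ContainsKttt H t

allSubsets : (n : ℕ) → List (Subset n)
allSubsets zero = [] ∷ []
allSubsets (suc n) = map (true ∷_) (allSubsets n) ++ map (false ∷_) (allSubsets n)

_⊆ᵇ_ : ∀ {n} → Subset n → Subset n → Bool
[] ⊆ᵇ [] = true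
(x ∷ S) ⊆ᵇ (y ∷ A) = (if x then y else true) ∧ (S ⊆ᵇ A)

allL : ∀ {A : Set} → (A → Bool) → List A → Bool
allL P = foldr (λ a b → P a ∧ b) true

isIndep : ∀ {n} → Graph n → Subset n → Bool
isIndep {n} H S =
  allL (λ u → allL (λ v →
    if lookup S u ∧ lookup S v then not (adj H u v) else true) (allFin n)) (allFin n)

maxL : List ℕ → ℕ
maxL = foldr ℕ._⊔_ 0

α[_] : ∀ {n} → Graph n → Subset n → ℕ
α[_] {n} H A = maxL (List.map ∣_∣
  (List.filterᵇ (λ S → (S ⊆ᵇ A) ∧ isIndep H S) (allSubsets n)))

-- probability of A under the p-random subset distribution
weight : ∀ {n} → ℚ → Subset n → ℚ
weight p [] = 1ℚ
weight p (true ∷ A) = p * weight p A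
weight p (false ∷ A) = (1ℚ - p) * weight p A

Pr : (n : ℕ) → ℚ → (Subset n → Bool) → ℚ
Pr n p E = foldr _+_ 0ℚ (List.map (λ A → if E A then weight p A else 0ℚ) (allSubsets n))

inv⁺ : (d : ℚ) → Positive d → ℚ
inv⁺ d dpos = (1/ d) {{pos⇒nonZero d {{dpos}}}}

{-# OPTIONS --safe #-}

-- Scan the vertices in a fixed order and build an independent set of H[A] greedily:
-- a vertex of A that is not yet blocked is taken, and its later neighbours become blocked.
-- With q = 1 - p + p c and ψ = c q^Δ, the moment 𝔼[ψ^|greedy|] is at most q^n, because every
-- blocked vertex carries a prepaid factor q. Markov's inequality gives
-- Pr[α(H[A]) ≤ N] ≤ q^n / ψ^N. For c = 1 - κ/4, Bernoulli's inequality yields q^R ≤ c and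
-- q^L ≤ 1/2 for R ≈ d/κ + d/2 and L ≈ 4d/κ², so the probability is at most
-- q^(n - (R+Δ)N) ≤ 2^-k whenever (R + Δ)N + Lk ≤ n, which holds for k ≤ κ⁴n/d⁵, d ≥ 24 and
-- n large.
module Submission where

open import Algebra.Bundles using (CommutativeMonoid)
open import Data.Bool using (Bool; true; false; T; if_then_else_; _∧_; not)
open import Data.Bool.Properties using (T?; ¬-not)
open import Data.Fin using (Fin; zero; suc)
open import Data.Fin.Subset using (Subset; ∣_∣; _∪_; ⊥)
open import Data.Fin.Subset.Properties using (∣p∣≤∣x∷p∣; ∣⊥∣≡0; x∈p∪q⁺)
import Data.Integer as ℤ
import Data.Integer.Properties as ℤ
open import Data.List using (List; []; _∷_; _++_; map; foldr; allFin)
open import Data.List.Membership.Propositional using (_∈_)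
open import Data.List.Membership.Propositional.Properties
  using (∈-map⁺; ∈-map⁻; ∈-++⁺ˡ; ∈-++⁺ʳ; ∈-filter⁺; ∈-allFin)
open import Data.List.Properties using (map-∘; map-cong)
open import Data.List.Relation.Unary.Any using (here; there)
open import Data.Nat as ℕ using (ℕ; zero; suc)
import Data.Nat.Coprimality as Coprime
import Data.Nat.Properties as ℕₚ
open import Data.Product using (Σ; _×_; _,_; proj₁; proj₂)
open import Data.Rational
  using ( ℚ; mkℚ; 0ℚ; 1ℚ; _+_; _*_; _-_; -_; _/_; _≤_; _<_; _≤ᵇ_; *≤*
        ; Positive; positive; nonNegative; _≟_; _≤?_)
open import Data.Rational.Properties
open import Data.Sum using (inj₁; inj₂)
-- Vec's constructors are only opened inside the modules that need them: overloaded with List's,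
-- they would make the variable lists passed to the ring solver ambiguous.
import Data.Vec
open import Data.Vec.Properties using (lookup∘tabulate; lookup⇒[]=)
open import Defs hiding (sym)
open import Function using (_∘_)
open import Level using (0ℓ)
open import Relation.Binary.PropositionalEquality
open import Relation.Nullary using (yes; no)
open import Relation.Nullary.Decidable using (dec⇒maybe)
open import Tactic.RingSolver using (solve; solve-∀)
import Tactic.RingSolver.Core.AlmostCommutativeRing as ACR

open import Algebra.Properties.CommutativeSemigroup
  (CommutativeMonoid.commutativeSemigroup *-1-commutativeMonoid)
  using (interchange; x∙yz≈y∙xz; xy∙z≈x∙zy)

ℚ-ring : ACR.AlmostCommutativeRing 0ℓ 0ℓ
ℚ-ring = ACR.fromCommutativeRing +-*-commutativeRing (λ x → dec⇒maybe (0ℚ ≟ x))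

ℕ→ℚ≡mkℚ : ∀ n → ℕ→ℚ n ≡ mkℚ (ℤ.+ n) 0 (Coprime.sym (Coprime.1-coprimeTo n))
ℕ→ℚ≡mkℚ n = normalize-coprime (Coprime.sym (Coprime.1-coprimeTo n))

ℕ→ℚ-+ : ∀ m n → ℕ→ℚ (m ℕ.+ n) ≡ ℕ→ℚ m + ℕ→ℚ n
ℕ→ℚ-+ m n rewrite ℕ→ℚ≡mkℚ m | ℕ→ℚ≡mkℚ n = sym (/-cong numerator refl)
  where
  numerator : ℤ.+ m ℤ.* ℤ.+ 1 ℤ.+ ℤ.+ n ℤ.* ℤ.+ 1 ≡ ℤ.+ (m ℕ.+ n)
  numerator rewrite ℤ.*-identityʳ (ℤ.+ m) | ℤ.*-identityʳ (ℤ.+ n) = sym (ℤ.pos-+ m n)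

ℕ→ℚ-* : ∀ m n → ℕ→ℚ (m ℕ.* n) ≡ ℕ→ℚ m * ℕ→ℚ n
ℕ→ℚ-* m n rewrite ℕ→ℚ≡mkℚ m | ℕ→ℚ≡mkℚ n = sym (/-cong (sym (ℤ.pos-* m n)) refl)

ℕ→ℚ-mono-≤ : ∀ {m n} → m ℕ.≤ n → ℕ→ℚ m ≤ ℕ→ℚ n
ℕ→ℚ-mono-≤ {m} {n} m≤n rewrite ℕ→ℚ≡mkℚ m | ℕ→ℚ≡mkℚ n =
  *≤* (subst₂ ℤ._≤_ (sym (ℤ.*-identityʳ (ℤ.+ m))) (sym (ℤ.*-identityʳ (ℤ.+ n))) (ℤ.+≤+ m≤n))

ℕ→ℚ-cancel-≤ : ∀ {m n} → ℕ→ℚ m ≤ ℕ→ℚ n → m ℕ.≤ n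
ℕ→ℚ-cancel-≤ {m} {n} m≤n rewrite ℕ→ℚ≡mkℚ m | ℕ→ℚ≡mkℚ n with m≤n
... | *≤* m*1≤n*1 =
  ℤ.drop‿+≤+ (subst₂ ℤ._≤_ (ℤ.*-identityʳ (ℤ.+ m)) (ℤ.*-identityʳ (ℤ.+ n)) m*1≤n*1)

0≤ℕ→ℚ : ∀ n → 0ℚ ≤ ℕ→ℚ n
0≤ℕ→ℚ n = ℕ→ℚ-mono-≤ (ℕ.z≤n {n})

0≤1 : 0ℚ ≤ 1ℚ
0≤1 = *≤* (ℤ.+≤+ ℕ.z≤n)

*-monoˡ-≤-0≤ : ∀ {r p q} → 0ℚ ≤ r → p ≤ q → r * p ≤ r * q
*-monoˡ-≤-0≤ {r} 0≤r = *-monoˡ-≤-nonNeg r {{nonNegative 0≤r}}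

*-monoʳ-≤-0≤ : ∀ {r p q} → 0ℚ ≤ r → p ≤ q → p * r ≤ q * r
*-monoʳ-≤-0≤ {r} 0≤r = *-monoʳ-≤-nonNeg r {{nonNegative 0≤r}}

*-mono-≤-0≤ : ∀ {p q r s} → 0ℚ ≤ p → 0ℚ ≤ r → p ≤ q → r ≤ s → p * r ≤ q * s
*-mono-≤-0≤ 0≤p 0≤r p≤q r≤s =
  ≤-trans (*-monoˡ-≤-0≤ 0≤p r≤s) (*-monoʳ-≤-0≤ (≤-trans 0≤r r≤s) p≤q)

0≤* : ∀ {p q} → 0ℚ ≤ p → 0ℚ ≤ q → 0ℚ ≤ p * q
0≤* {p} {q} 0≤p 0≤q = subst (_≤ p * q) (*-zeroˡ q) (*-monoʳ-≤-0≤ 0≤q 0≤p)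

0≤+ : ∀ {p q} → 0ℚ ≤ p → 0ℚ ≤ q → 0ℚ ≤ p + q
0≤+ 0≤p 0≤q = +-mono-≤ 0≤p 0≤q

p≤q⇒0≤q-p : ∀ {p q} → p ≤ q → 0ℚ ≤ q - p
p≤q⇒0≤q-p {p} {q} p≤q = subst (_≤ q - p) (+-inverseʳ p) (+-monoˡ-≤ (- p) p≤q)

*-≤1 : ∀ {p q} → 0ℚ ≤ p → p ≤ 1ℚ → 0ℚ ≤ q → q ≤ 1ℚ → p * q ≤ 1ℚ
*-≤1 0≤p p≤1 0≤q q≤1 = *-mono-≤-0≤ 0≤p 0≤q p≤1 q≤1

≤-by-slack : ∀ {p q} t → 0ℚ ≤ t → q ≡ p + t → p ≤ q
≤-by-slack {p} t 0≤t q≡p+t = subst₂ _≤_ (+-identityʳ p) (sym q≡p+t) (+-monoʳ-≤ p 0≤t)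

^ℚ-+ : ∀ x m n → x ^ℚ (m ℕ.+ n) ≡ x ^ℚ m * x ^ℚ n
^ℚ-+ x zero    n = sym (*-identityˡ _)
^ℚ-+ x (suc m) n = trans (cong (x *_) (^ℚ-+ x m n)) (sym (*-assoc x _ _))

^ℚ-* : ∀ x m n → x ^ℚ (m ℕ.* n) ≡ (x ^ℚ m) ^ℚ n
^ℚ-* x m zero    = cong (x ^ℚ_) (ℕₚ.*-zeroʳ m)
^ℚ-* x m (suc n) = begin
  x ^ℚ (m ℕ.* suc n)         ≡⟨ cong (x ^ℚ_) (ℕₚ.*-suc m n) ⟩
  x ^ℚ (m ℕ.+ m ℕ.* n)       ≡⟨ ^ℚ-+ x m (m ℕ.* n) ⟩
  x ^ℚ m * x ^ℚ (m ℕ.* n)    ≡⟨ cong (x ^ℚ m *_) (^ℚ-* x m n) ⟩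
  x ^ℚ m * (x ^ℚ m) ^ℚ n     ∎
  where open ≡-Reasoning

*-^ℚ : ∀ x y n → (x * y) ^ℚ n ≡ x ^ℚ n * y ^ℚ n
*-^ℚ x y zero    = refl
*-^ℚ x y (suc n) = trans (cong ((x * y) *_) (*-^ℚ x y n)) (interchange x y _ _)

0≤^ℚ : ∀ {x} n → 0ℚ ≤ x → 0ℚ ≤ x ^ℚ n
0≤^ℚ zero    _   = 0≤1
0≤^ℚ (suc n) 0≤x = 0≤* 0≤x (0≤^ℚ n 0≤x)

0<^ℚ : ∀ {x} n → 0ℚ < x → 0ℚ < x ^ℚ n
0<^ℚ zero    _ = positive⁻¹ 1ℚ
0<^ℚ {x} (suc n) 0<x = positive⁻¹ (x * x ^ℚ n)
  {{pos*pos⇒pos x {{positive 0<x}} (x ^ℚ n) {{positive (0<^ℚ n 0<x)}}}}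

^ℚ-monoˡ-≤ : ∀ {x y} n → 0ℚ ≤ x → x ≤ y → x ^ℚ n ≤ y ^ℚ n
^ℚ-monoˡ-≤ zero    _   _   = ≤-refl
^ℚ-monoˡ-≤ (suc n) 0≤x x≤y = *-mono-≤-0≤ 0≤x (0≤^ℚ n 0≤x) x≤y (^ℚ-monoˡ-≤ n 0≤x x≤y)

^ℚ-≤1 : ∀ {x} n → 0ℚ ≤ x → x ≤ 1ℚ → x ^ℚ n ≤ 1ℚ
^ℚ-≤1 n 0≤x x≤1 = ≤-trans (^ℚ-monoˡ-≤ n 0≤x x≤1) (≤-reflexive (1^ℚn n))
  where
  1^ℚn : ∀ n → 1ℚ ^ℚ n ≡ 1ℚ
  1^ℚn zero    = refl
  1^ℚn (suc n) = trans (*-identityˡ _) (1^ℚn n)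

^ℚ-antiʳ-≤ : ∀ {x m n} → 0ℚ ≤ x → x ≤ 1ℚ → m ℕ.≤ n → x ^ℚ n ≤ x ^ℚ m
^ℚ-antiʳ-≤ {x} {m} 0≤x x≤1 m≤n with ℕₚ.m≤n⇒∃[o]m+o≡n m≤n
... | o , refl = begin
  x ^ℚ (m ℕ.+ o)     ≡⟨ ^ℚ-+ x m o ⟩
  x ^ℚ m * x ^ℚ o    ≤⟨ *-monoˡ-≤-0≤ (0≤^ℚ m 0≤x) (^ℚ-≤1 o 0≤x x≤1) ⟩
  x ^ℚ m * 1ℚ        ≡⟨ *-identityʳ _ ⟩
  x ^ℚ m             ∎
  where open ≤-Reasoning

bernoulli : ∀ {x} n → 0ℚ ≤ x → x ≤ 1ℚ → (1ℚ - x) ^ℚ n * (1ℚ + ℕ→ℚ n * x) ≤ 1ℚ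
bernoulli {x} zero    _   _   = ≤-reflexive (solve (x ∷ []) ℚ-ring)
bernoulli {x} (suc n) 0≤x x≤1 = begin
  (1ℚ - x) ^ℚ suc n * (1ℚ + ℕ→ℚ (suc n) * x)
    ≡⟨ cong (λ m → (1ℚ - x) ^ℚ suc n * (1ℚ + m * x)) (ℕ→ℚ-+ 1 n) ⟩
  (1ℚ - x) * y * (1ℚ + (1ℚ + r) * x)
    ≤⟨ ≤-by-slack (y * ((1ℚ + r) * (x * x))) slack≥0 (split y r) ⟩
  y * (1ℚ + r * x)
    ≤⟨ bernoulli n 0≤x x≤1 ⟩
  1ℚ ∎
  where
  open ≤-Reasoning
  y = (1ℚ - x) ^ℚ n
  r = ℕ→ℚ n
  slack≥0 : 0ℚ ≤ y * ((1ℚ + r) * (x * x))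
  slack≥0 = 0≤* (0≤^ℚ n (p≤q⇒0≤q-p x≤1)) (0≤* (0≤+ 0≤1 (0≤ℕ→ℚ n)) (0≤* 0≤x 0≤x))
  split : ∀ y r → y * (1ℚ + r * x) ≡ (1ℚ - x) * y * (1ℚ + (1ℚ + r) * x) + y * ((1ℚ + r) * (x * x))
  split y r = solve (y ∷ r ∷ x ∷ []) ℚ-ring

bernoulli-≤ : ∀ {x y} n → 0ℚ ≤ x → x ≤ 1ℚ → 0ℚ ≤ y → 1ℚ ≤ y * (1ℚ + ℕ→ℚ n * x) →
              (1ℚ - x) ^ℚ n ≤ y
bernoulli-≤ {x} {y} n 0≤x x≤1 0≤y 1≤y[1+nx] = begin
  (1ℚ - x) ^ℚ n                            ≡⟨ *-identityʳ _ ⟨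
  (1ℚ - x) ^ℚ n * 1ℚ                       ≤⟨ *-monoˡ-≤-0≤ (0≤^ℚ n (p≤q⇒0≤q-p x≤1)) 1≤y[1+nx] ⟩
  (1ℚ - x) ^ℚ n * (y * (1ℚ + ℕ→ℚ n * x))   ≡⟨ x∙yz≈y∙xz ((1ℚ - x) ^ℚ n) y _ ⟩
  y * ((1ℚ - x) ^ℚ n * (1ℚ + ℕ→ℚ n * x))   ≤⟨ *-monoˡ-≤-0≤ 0≤y (bernoulli n 0≤x x≤1) ⟩
  y * 1ℚ                                   ≡⟨ *-identityʳ y ⟩
  y                                        ∎
  where open ≤-Reasoning

≤-pow-cancel : ∀ {P q} a b {n} → 0ℚ < q → q ≤ 1ℚ → P * q ^ℚ a ≤ q ^ℚ n → a ℕ.+ b ℕ.≤ n → P ≤ q ^ℚ b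
≤-pow-cancel {P} {q} a b {n} 0<q q≤1 P*q^a≤q^n a+b≤n =
  *-cancelˡ-≤-pos (q ^ℚ a) {{positive (0<^ℚ a 0<q)}} (begin
    q ^ℚ a * P         ≡⟨ *-comm (q ^ℚ a) P ⟩
    P * q ^ℚ a         ≤⟨ P*q^a≤q^n ⟩
    q ^ℚ n             ≤⟨ ^ℚ-antiʳ-≤ (<⇒≤ 0<q) q≤1 a+b≤n ⟩
    q ^ℚ (a ℕ.+ b)     ≡⟨ ^ℚ-+ q a b ⟩
    q ^ℚ a * q ^ℚ b    ∎)
  where open ≤-Reasoning

^ℚ-halving : ∀ {y} k → 0ℚ ≤ y → y * ℕ→ℚ 2 ≤ 1ℚ → y ^ℚ k * ℕ→ℚ 2 ^ℚ k ≤ 1ℚ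
^ℚ-halving {y} k 0≤y 2y≤1 = subst (_≤ 1ℚ) (*-^ℚ y (ℕ→ℚ 2) k) (^ℚ-≤1 k (0≤* 0≤y (0≤ℕ→ℚ 2)) 2y≤1)

archimedean : ∀ r → Σ ℕ λ n → r ≤ ℕ→ℚ n
archimedean r@(mkℚ (ℤ.+ m) d-1 _) = m , subst (r ≤_) (sym (ℕ→ℚ≡mkℚ m)) (*≤* m*1≤m*d)
  where
  m*1≤m*d : ℤ.+ m ℤ.* ℤ.+ 1 ℤ.≤ ℤ.+ m ℤ.* ℤ.+ suc d-1
  m*1≤m*d rewrite sym (ℤ.pos-* m 1) | sym (ℤ.pos-* m (suc d-1)) =
    ℤ.+≤+ (ℕₚ.*-monoʳ-≤ m (ℕ.s≤s ℕ.z≤n))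
archimedean r@(mkℚ ℤ.-[1+ _ ] _ _) = 0 , nonPositive⁻¹ r

-- Opaque so that unification never unfolds the search.
opaque
  ℕ-ceiling : ∀ r → 0ℚ ≤ r → Σ ℕ λ n → r ≤ ℕ→ℚ n × ℕ→ℚ n ≤ r + 1ℚ
  ℕ-ceiling r 0≤r = search (proj₁ (archimedean r)) (proj₂ (archimedean r))
    where
    search : ∀ n → r ≤ ℕ→ℚ n → Σ ℕ λ n → r ≤ ℕ→ℚ n × ℕ→ℚ n ≤ r + 1ℚ
    search zero    r≤0 = 0 , r≤0 , ≤-trans 0≤r (≤-by-slack 1ℚ 0≤1 refl)
    search (suc n) r≤1+n with r ≤? ℕ→ℚ n
    ... | yes r≤n = search n r≤n
    ... | no  r≰n = suc n , r≤1+n , (begin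
      ℕ→ℚ (suc n)    ≡⟨ trans (ℕ→ℚ-+ 1 n) (+-comm 1ℚ (ℕ→ℚ n)) ⟩
      ℕ→ℚ n + 1ℚ     ≤⟨ +-monoˡ-≤ 1ℚ (<⇒≤ (≰⇒> r≰n)) ⟩
      r + 1ℚ         ∎)
      where open ≤-Reasoning

maxL-upper : ∀ {x} xs → x ∈ xs → x ℕ.≤ maxL xs
maxL-upper (y ∷ ys) (here refl) = ℕₚ.m≤m⊔n y _
maxL-upper (y ∷ ys) (there x∈ys) = ℕₚ.≤-trans (maxL-upper ys x∈ys) (ℕₚ.m≤n⊔m y _)

maxL-least : ∀ {B} xs → 0ℚ ≤ B → (∀ x → x ∈ xs → ℕ→ℚ x ≤ B) → ℕ→ℚ (maxL xs) ≤ B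
maxL-least []       0≤B _ = 0≤B
maxL-least (x ∷ xs) 0≤B all≤B with ℕₚ.⊔-sel x (maxL xs)
... | inj₁ max≡x rewrite max≡x = all≤B x (here refl)
... | inj₂ max≡m rewrite max≡m = maxL-least xs 0≤B (λ y y∈xs → all≤B y (there y∈xs))

module RandomSubsets where

  open Data.Vec using ([]; _∷_)

  ∑ : {A : Set} → (A → ℚ) → List A → ℚ
  ∑ f xs = foldr _+_ 0ℚ (map f xs)

  ∑-++ : ∀ {A : Set} (f : A → ℚ) xs ys → ∑ f (xs ++ ys) ≡ ∑ f xs + ∑ f ys
  ∑-++ f []       ys = sym (+-identityˡ _)
  ∑-++ f (x ∷ xs) ys = trans (cong (f x +_) (∑-++ f xs ys)) (sym (+-assoc (f x) _ _))

  ∑-map : ∀ {A B : Set} (f : B → ℚ) (g : A → B) xs → ∑ f (map g xs) ≡ ∑ (f ∘ g) xs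
  ∑-map f g xs = cong (foldr _+_ 0ℚ) (sym (map-∘ xs))

  ∑-cong : ∀ {A : Set} {f g : A → ℚ} xs → (∀ x → f x ≡ g x) → ∑ f xs ≡ ∑ g xs
  ∑-cong xs f≗g = cong (foldr _+_ 0ℚ) (map-cong f≗g xs)

  ∑-*ˡ : ∀ {A : Set} c (f : A → ℚ) xs → ∑ (λ x → c * f x) xs ≡ c * ∑ f xs
  ∑-*ˡ c f []       = sym (*-zeroʳ c)
  ∑-*ˡ c f (x ∷ xs) = trans (cong (c * f x +_) (∑-*ˡ c f xs)) (sym (*-distribˡ-+ c (f x) _))

  ∑-mono-≤ : ∀ {A : Set} {f g : A → ℚ} xs → (∀ x → f x ≤ g x) → ∑ f xs ≤ ∑ g xs
  ∑-mono-≤ []       f≤g = ≤-refl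
  ∑-mono-≤ (x ∷ xs) f≤g = +-mono-≤ (f≤g x) (∑-mono-≤ xs f≤g)

  0≤∑ : ∀ {A : Set} {f : A → ℚ} xs → (∀ x → 0ℚ ≤ f x) → 0ℚ ≤ ∑ f xs
  0≤∑ []       0≤f = ≤-refl
  0≤∑ (x ∷ xs) 0≤f = 0≤+ (0≤f x) (0≤∑ xs 0≤f)

  𝔼 : (n : ℕ) → ℚ → (Subset n → ℚ) → ℚ
  𝔼 n p f = ∑ (λ A → f A * weight p A) (allSubsets n)

  0≤weight : ∀ {n p} → 0ℚ ≤ p → p ≤ 1ℚ → (A : Subset n) → 0ℚ ≤ weight p A
  0≤weight 0≤p p≤1 []          = 0≤1
  0≤weight 0≤p p≤1 (true  ∷ A) = 0≤* 0≤p (0≤weight 0≤p p≤1 A)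
  0≤weight 0≤p p≤1 (false ∷ A) = 0≤* (p≤q⇒0≤q-p p≤1) (0≤weight 0≤p p≤1 A)

  0≤𝔼 : ∀ {n p} (f : Subset n → ℚ) → 0ℚ ≤ p → p ≤ 1ℚ → (∀ A → 0ℚ ≤ f A) → 0ℚ ≤ 𝔼 n p f
  0≤𝔼 {n} f 0≤p p≤1 0≤f = 0≤∑ (allSubsets n) (λ A → 0≤* (0≤f A) (0≤weight 0≤p p≤1 A))

  𝔼-*ˡ : ∀ n p c (f : Subset n → ℚ) → 𝔼 n p (λ A → c * f A) ≡ c * 𝔼 n p f
  𝔼-*ˡ n p c f = trans (∑-cong (allSubsets n) (λ A → *-assoc c (f A) _)) (∑-*ˡ c _ (allSubsets n))

  𝔼-suc : ∀ n p (f : Subset (suc n) → ℚ) →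
          𝔼 (suc n) p f ≡ p * 𝔼 n p (f ∘ (true ∷_)) + (1ℚ - p) * 𝔼 n p (f ∘ (false ∷_))
  𝔼-suc n p f = begin
    𝔼 (suc n) p f
      ≡⟨ ∑-++ _ (map (true ∷_) (allSubsets n)) _ ⟩
    ∑ term (map (true ∷_) (allSubsets n)) + ∑ term (map (false ∷_) (allSubsets n))
      ≡⟨ cong₂ _+_ (first-vertex true p λ _ → refl) (first-vertex false (1ℚ - p) λ _ → refl) ⟩
    p * 𝔼 n p (f ∘ (true ∷_)) + (1ℚ - p) * 𝔼 n p (f ∘ (false ∷_)) ∎
    where
    open ≡-Reasoning
    term : Subset (suc n) → ℚ
    term A = f A * weight p A
    first-vertex : ∀ b w → (∀ A → weight p (b ∷ A) ≡ w * weight p A) →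
                   ∑ term (map (b ∷_) (allSubsets n)) ≡ w * 𝔼 n p (f ∘ (b ∷_))
    first-vertex b w weight≡ = begin
      ∑ term (map (b ∷_) (allSubsets n))
        ≡⟨ ∑-map term (b ∷_) (allSubsets n) ⟩
      ∑ (λ A → f (b ∷ A) * weight p (b ∷ A)) (allSubsets n)
        ≡⟨ ∑-cong (allSubsets n) (λ A →
             trans (cong (f (b ∷ A) *_) (weight≡ A)) (x∙yz≈y∙xz (f (b ∷ A)) w _)) ⟩
      ∑ (λ A → w * (f (b ∷ A) * weight p A)) (allSubsets n)
        ≡⟨ ∑-*ˡ w _ (allSubsets n) ⟩
      w * 𝔼 n p (f ∘ (b ∷_)) ∎

  markov : ∀ {n p} (E : Subset n → Bool) (c : ℚ) (f : Subset n → ℚ) → 0ℚ ≤ p → p ≤ 1ℚ →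
           (∀ A → 0ℚ ≤ f A) → (∀ A → E A ≡ true → c ≤ f A) → Pr n p E * c ≤ 𝔼 n p f
  markov {n} {p} E c f 0≤p p≤1 0≤f E⇒c≤f = begin
    Pr n p E * c                                             ≡⟨ *-comm _ c ⟩
    c * Pr n p E                                             ≡⟨ ∑-*ˡ c _ (allSubsets n) ⟨
    ∑ (λ A → c * (if E A then weight p A else 0ℚ)) (allSubsets n) ≤⟨ ∑-mono-≤ (allSubsets n) pointwise ⟩
    𝔼 n p f                                                  ∎
    where
    open ≤-Reasoning
    pointwise : ∀ A → c * (if E A then weight p A else 0ℚ) ≤ f A * weight p A
    pointwise A with E A in E[A]
    ... | true  = *-monoʳ-≤-0≤ (0≤weight 0≤p p≤1 A) (E⇒c≤f A E[A])
    ... | false = subst (_≤ f A * weight p A) (sym (*-zeroʳ c)) (0≤* (0≤f A) (0≤weight 0≤p p≤1 A))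

  0≤Pr : ∀ {n p} (E : Subset n → Bool) → 0ℚ ≤ p → p ≤ 1ℚ → 0ℚ ≤ Pr n p E
  0≤Pr {n} {p} E 0≤p p≤1 = 0≤∑ (allSubsets n) indicator≥0
    where
    indicator≥0 : ∀ A → 0ℚ ≤ (if E A then weight p A else 0ℚ)
    indicator≥0 A with E A
    ... | true  = 0≤weight 0≤p p≤1 A
    ... | false = ≤-refl

open RandomSubsets

module GreedyIndependentSet where

  open Data.Vec using ([]; _∷_; tabulate; lookup; here; there)
  open import Data.Fin.Subset using (_∉_) renaming (_∈_ to _∈ₛ_)

  Adjacency : ℕ → Set
  Adjacency n = Fin n → Fin n → Bool

  dropFirst : ∀ {n} → Adjacency (suc n) → Adjacency n
  dropFirst a u v = a (suc u) (suc v)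

  neighbours₀ : ∀ {n} → Adjacency (suc n) → Subset n
  neighbours₀ a = tabulate (λ v → a zero (suc v))

  greedy : ∀ {n} → Adjacency n → (blocked : Subset n) → Subset n → Subset n
  greedy a []           []          = []
  greedy a (true  ∷ bs) (_     ∷ A) = false ∷ greedy (dropFirst a) bs A
  greedy a (false ∷ bs) (true  ∷ A) = true  ∷ greedy (dropFirst a) (bs ∪ neighbours₀ a) A
  greedy a (false ∷ bs) (false ∷ A) = false ∷ greedy (dropFirst a) bs A

  DegreeAtMost : ∀ {n} → Adjacency n → ℕ → Set
  DegreeAtMost a D = ∀ v → ∣ tabulate (a v) ∣ ℕ.≤ D

  DegreeAtMost-dropFirst : ∀ {n D} (a : Adjacency (suc n)) →
                           DegreeAtMost a D → DegreeAtMost (dropFirst a) D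
  DegreeAtMost-dropFirst a a≤D v =
    ℕₚ.≤-trans (∣p∣≤∣x∷p∣ (a (suc v) zero) (tabulate (dropFirst a v))) (a≤D (suc v))

  ∣p∪q∣≤∣p∣+∣q∣ : ∀ {n} (p q : Subset n) → ∣ p ∪ q ∣ ℕ.≤ ∣ p ∣ ℕ.+ ∣ q ∣
  ∣p∪q∣≤∣p∣+∣q∣ []          []          = ℕ.z≤n
  ∣p∪q∣≤∣p∣+∣q∣ (true  ∷ p) (x     ∷ q) =
    ℕ.s≤s (ℕₚ.≤-trans (∣p∪q∣≤∣p∣+∣q∣ p q) (ℕₚ.+-monoʳ-≤ ∣ p ∣ (∣p∣≤∣x∷p∣ x q)))
  ∣p∪q∣≤∣p∣+∣q∣ (false ∷ p) (true  ∷ q) =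
    subst (∣ p ∪ q ∣ ℕ.<_) (sym (ℕₚ.+-suc ∣ p ∣ ∣ q ∣)) (ℕ.s≤s (∣p∪q∣≤∣p∣+∣q∣ p q))
  ∣p∪q∣≤∣p∣+∣q∣ (false ∷ p) (false ∷ q) = ∣p∪q∣≤∣p∣+∣q∣ p q

  ∣b∪neighbours₀∣≤ : ∀ {n D} (a : Adjacency (suc n)) → DegreeAtMost a D →
                     ∀ b → ∣ b ∪ neighbours₀ a ∣ ℕ.≤ D ℕ.+ ∣ b ∣
  ∣b∪neighbours₀∣≤ {D = D} a a≤D b = begin
    ∣ b ∪ neighbours₀ a ∣        ≤⟨ ∣p∪q∣≤∣p∣+∣q∣ b (neighbours₀ a) ⟩
    ∣ b ∣ ℕ.+ ∣ neighbours₀ a ∣  ≤⟨ ℕₚ.+-monoʳ-≤ ∣ b ∣ (∣p∣≤∣x∷p∣ (a zero zero) (neighbours₀ a)) ⟩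
    ∣ b ∣ ℕ.+ ∣ tabulate (a zero) ∣ ≤⟨ ℕₚ.+-monoʳ-≤ ∣ b ∣ (a≤D zero) ⟩
    ∣ b ∣ ℕ.+ D                  ≡⟨ ℕₚ.+-comm ∣ b ∣ D ⟩
    D ℕ.+ ∣ b ∣                  ∎
    where open ℕₚ.≤-Reasoning

  Independent : ∀ {n} → Adjacency n → Subset n → Set
  Independent a S = ∀ {u v} → u ∈ₛ S → v ∈ₛ S → a u v ≡ false

  independent-false∷ : ∀ {n} (a : Adjacency (suc n)) {S} →
                       Independent (dropFirst a) S → Independent a (false ∷ S)
  independent-false∷ a S-ind (there u∈S) (there v∈S) = S-ind u∈S v∈S

  record IsSimple {n} (a : Adjacency n) : Set where
    field
      symmetric   : ∀ u v → a u v ≡ a v u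
      irreflexive : ∀ v → a v v ≡ false

  IsSimple-dropFirst : ∀ {n} {a : Adjacency (suc n)} → IsSimple a → IsSimple (dropFirst a)
  IsSimple-dropFirst a-simple = record
    { symmetric   = λ u v → IsSimple.symmetric a-simple (suc u) (suc v)
    ; irreflexive = λ v → IsSimple.irreflexive a-simple (suc v)
    }

  independent-true∷ : ∀ {n} (a : Adjacency (suc n)) {S} → IsSimple a →
                      Independent (dropFirst a) S → (∀ {v} → v ∈ₛ S → a zero (suc v) ≡ false) →
                      Independent a (true ∷ S)
  independent-true∷ a a-simple S-ind S-away here                here        =
    IsSimple.irreflexive a-simple zero
  independent-true∷ a a-simple S-ind S-away here                (there v∈S) = S-away v∈S
  independent-true∷ a a-simple S-ind S-away (there {i = u} u∈S) here        =
    trans (IsSimple.symmetric a-simple (suc u) zero) (S-away u∈S)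
  independent-true∷ a a-simple S-ind S-away (there u∈S)         (there v∈S) = S-ind u∈S v∈S

  ∉neighbours₀ : ∀ {n} (a : Adjacency (suc n)) {v} → v ∉ neighbours₀ a → a zero (suc v) ≡ false
  ∉neighbours₀ a {v} v∉N = ¬-not (v∉N ∘ lookup⇒[]= v (neighbours₀ a) ∘ trans (lookup∘tabulate _ v))

  greedy-avoids-blocked : ∀ {n} (a : Adjacency n) b A {v} → v ∈ₛ greedy a b A → v ∉ b
  greedy-avoids-blocked a (true  ∷ bs) (_ ∷ A)     (there v∈G) (there v∈b) =
    greedy-avoids-blocked (dropFirst a) bs A v∈G v∈b
  greedy-avoids-blocked a (false ∷ bs) (true ∷ A)  (there v∈G) (there v∈b) =
    greedy-avoids-blocked (dropFirst a) (bs ∪ neighbours₀ a) A v∈G (x∈p∪q⁺ (inj₁ v∈b))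
  greedy-avoids-blocked a (false ∷ bs) (false ∷ A) (there v∈G) (there v∈b) =
    greedy-avoids-blocked (dropFirst a) bs A v∈G v∈b

  greedy-independent : ∀ {n} (a : Adjacency n) → IsSimple a → ∀ b A → Independent a (greedy a b A)
  greedy-independent a a-simple []           []          ()
  greedy-independent a a-simple (true  ∷ bs) (_     ∷ A) =
    independent-false∷ a (greedy-independent (dropFirst a) (IsSimple-dropFirst a-simple) bs A)
  greedy-independent a a-simple (false ∷ bs) (true  ∷ A) =
    independent-true∷ a a-simple
      (greedy-independent (dropFirst a) (IsSimple-dropFirst a-simple) (bs ∪ neighbours₀ a) A)
      (λ v∈G → ∉neighbours₀ a (greedy-avoids-blocked (dropFirst a) _ A v∈G ∘ x∈p∪q⁺ ∘ inj₂))
  greedy-independent a a-simple (false ∷ bs) (false ∷ A) =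
    independent-false∷ a (greedy-independent (dropFirst a) (IsSimple-dropFirst a-simple) bs A)

  greedy-⊆ : ∀ {n} (a : Adjacency n) b A → (greedy a b A ⊆ᵇ A) ≡ true
  greedy-⊆ a []           []          = refl
  greedy-⊆ a (true  ∷ bs) (_     ∷ A) = greedy-⊆ (dropFirst a) bs A
  greedy-⊆ a (false ∷ bs) (true  ∷ A) = greedy-⊆ (dropFirst a) (bs ∪ neighbours₀ a) A
  greedy-⊆ a (false ∷ bs) (false ∷ A) = greedy-⊆ (dropFirst a) bs A

  allL-true : ∀ {A : Set} (P : A → Bool) xs → (∀ x → P x ≡ true) → allL P xs ≡ true
  allL-true P []       _      = refl
  allL-true P (x ∷ xs) P≡true rewrite P≡true x = allL-true P xs P≡true

  isIndep-complete : ∀ {n} (H : Graph n) S → Independent (adj H) S → isIndep H S ≡ true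
  isIndep-complete {n} H S S-ind =
    allL-true _ (allFin n) (λ u → allL-true _ (allFin n) (pair-ok u))
    where
    pair-ok : ∀ u v → (if lookup S u ∧ lookup S v then not (adj H u v) else true) ≡ true
    pair-ok u v with lookup S u in S[u] | lookup S v in S[v]
    ... | true  | true  = cong not (S-ind (lookup⇒[]= u S S[u]) (lookup⇒[]= v S S[v]))
    ... | true  | false = refl
    ... | false | _     = refl

  ∈-allSubsets : ∀ {n} (S : Subset n) → S ∈ allSubsets n
  ∈-allSubsets []                  = here refl
  ∈-allSubsets         (true  ∷ S) = ∈-++⁺ˡ (∈-map⁺ (true ∷_) (∈-allSubsets S))
  ∈-allSubsets {suc n} (false ∷ S) =
    ∈-++⁺ʳ (map (true ∷_) (allSubsets n)) (∈-map⁺ (false ∷_) (∈-allSubsets S))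

  α-maximum : ∀ {n} (H : Graph n) A S → (S ⊆ᵇ A) ≡ true → isIndep H S ≡ true → ∣ S ∣ ℕ.≤ α[ H ] A
  α-maximum H A S S⊆A S-ind =
    maxL-upper _ (∈-map⁺ ∣_∣ (∈-filter⁺ (λ S → T? ((S ⊆ᵇ A) ∧ isIndep H S)) (∈-allSubsets S) S-ok))
    where
    S-ok : T ((S ⊆ᵇ A) ∧ isIndep H S)
    S-ok rewrite S⊆A | S-ind = _

  greedy≤α : ∀ {n} (H : Graph n) b A → ∣ greedy (adj H) b A ∣ ℕ.≤ α[ H ] A
  greedy≤α H b A = α-maximum H A (greedy (adj H) b A) (greedy-⊆ (adj H) b A)
    (isIndep-complete H _ (greedy-independent (adj H) H-simple b A))
    where
    H-simple : IsSimple (adj H)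
    H-simple = record { symmetric = Graph.sym H ; irreflexive = irrefl H }

open GreedyIndependentSet

module VertexWeight (p c : ℚ) (0≤p : 0ℚ ≤ p) (p≤1 : p ≤ 1ℚ) (0≤c : 0ℚ ≤ c) (c≤1 : c ≤ 1ℚ) where

  q : ℚ
  q = 1ℚ - p + p * c

  0≤q : 0ℚ ≤ q
  0≤q = 0≤+ (p≤q⇒0≤q-p p≤1) (0≤* 0≤p 0≤c)

  q≤1 : q ≤ 1ℚ
  q≤1 = ≤-by-slack (p * (1ℚ - c)) (0≤* 0≤p (p≤q⇒0≤q-p c≤1)) (split p c)
    where
    split : ∀ p c → 1ℚ ≡ 1ℚ - p + p * c + p * (1ℚ - c)
    split = solve-∀ ℚ-ring

  c≤q : c ≤ q
  c≤q = ≤-by-slack ((1ℚ - c) * (1ℚ - p)) (0≤* (p≤q⇒0≤q-p c≤1) (p≤q⇒0≤q-p p≤1)) (split p c)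
    where
    split : ∀ p c → 1ℚ - p + p * c ≡ c + (1ℚ - c) * (1ℚ - p)
    split = solve-∀ ℚ-ring

  q^-bernoulli : ∀ R {y} → 0ℚ ≤ y → 1ℚ ≤ y * (1ℚ + ℕ→ℚ R * (p * (1ℚ - c))) → q ^ℚ R ≤ y
  q^-bernoulli R 0≤y premise =
    subst (λ z → z ^ℚ R ≤ _) (sym (q≡1-x p c)) (bernoulli-≤ R 0≤x x≤1 0≤y premise)
    where
    q≡1-x : ∀ p c → 1ℚ - p + p * c ≡ 1ℚ - p * (1ℚ - c)
    q≡1-x = solve-∀ ℚ-ring
    0≤1-c : 0ℚ ≤ 1ℚ - c
    0≤1-c = p≤q⇒0≤q-p c≤1
    0≤x : 0ℚ ≤ p * (1ℚ - c)
    0≤x = 0≤* 0≤p 0≤1-c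
    x≤1 : p * (1ℚ - c) ≤ 1ℚ
    x≤1 = *-≤1 0≤p p≤1 0≤1-c (≤-by-slack c 0≤c (one≡ c))
      where
      one≡ : ∀ c → 1ℚ ≡ 1ℚ - c + c
      one≡ = solve-∀ ℚ-ring

module GreedyPotential (p c : ℚ) (D : ℕ) (0≤p : 0ℚ ≤ p) (p≤1 : p ≤ 1ℚ) (0≤c : 0ℚ ≤ c) (c≤1 : c ≤ 1ℚ) where

  open Data.Vec using ([]; _∷_)
  open VertexWeight p c 0≤p p≤1 0≤c c≤1

  ψ : ℚ
  ψ = c * q ^ℚ D

  0≤ψ : 0ℚ ≤ ψ
  0≤ψ = 0≤* 0≤c (0≤^ℚ D 0≤q)

  ψ≤1 : ψ ≤ 1ℚ
  ψ≤1 = *-≤1 0≤c c≤1 (0≤^ℚ D 0≤q) (^ℚ-≤1 D 0≤q q≤1)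

  Φ : ∀ {n} → Adjacency n → Subset n → Subset n → ℚ
  Φ a b A = ψ ^ℚ ∣ greedy a b A ∣

  0≤Φ : ∀ {n} (a : Adjacency n) b A → 0ℚ ≤ Φ a b A
  0≤Φ a b A = 0≤^ℚ ∣ greedy a b A ∣ 0≤ψ

  -- An unblocked first vertex contributes q = (1 - p) · 1 + p · c on average: taken (probability p),
  -- it contributes ψ = c q^D and blocks at most D new vertices, whose factors q were prepaid.
  potential : ∀ {n} (a : Adjacency n) → DegreeAtMost a D → (b : Subset n) →
              𝔼 n p (Φ a b) * q ^ℚ ∣ b ∣ ≤ q ^ℚ n
  potential a _ [] = ≤-refl
  potential {suc n} a a≤D (true ∷ bs) = begin
    𝔼 (suc n) p (Φ a (true ∷ bs)) * (q * q ^ℚ ∣ bs ∣)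
      ≡⟨ cong (_* (q * q ^ℚ ∣ bs ∣)) (𝔼-suc n p (Φ a (true ∷ bs))) ⟩
    (p * E + (1ℚ - p) * E) * (q * q ^ℚ ∣ bs ∣)
      ≡⟨ average p E q (q ^ℚ ∣ bs ∣) ⟩
    q * (E * q ^ℚ ∣ bs ∣)
      ≤⟨ *-monoˡ-≤-0≤ 0≤q (potential (dropFirst a) (DegreeAtMost-dropFirst a a≤D) bs) ⟩
    q * q ^ℚ n ∎
    where
    open ≤-Reasoning
    E = 𝔼 n p (Φ (dropFirst a) bs)
    average : ∀ p e q r → (p * e + (1ℚ - p) * e) * (q * r) ≡ q * (e * r)
    average = solve-∀ ℚ-ring
  potential {suc n} a a≤D (false ∷ bs) = begin
    𝔼 (suc n) p (Φ a (false ∷ bs)) * r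
      ≡⟨ cong (_* r) (trans (𝔼-suc n p (Φ a (false ∷ bs)))
                    (cong (λ e → p * e + (1ℚ - p) * E-skip) (𝔼-*ˡ n p ψ (Φ (dropFirst a) b′)))) ⟩
    (p * (ψ * E-take) + (1ℚ - p) * E-skip) * r
      ≡⟨ distribute p ψ E-take E-skip r ⟩
    p * ((ψ * r) * E-take) + (1ℚ - p) * (E-skip * r)
      ≤⟨ +-mono-≤ (*-monoˡ-≤-0≤ 0≤p take) (*-monoˡ-≤-0≤ (p≤q⇒0≤q-p p≤1) (IH bs)) ⟩
    p * (c * q ^ℚ n) + (1ℚ - p) * q ^ℚ n
      ≡⟨ collect p c (q ^ℚ n) ⟩
    q * q ^ℚ n ∎
    where
    open ≤-Reasoning
    b′ = bs ∪ neighbours₀ a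
    r = q ^ℚ ∣ bs ∣
    E-take = 𝔼 n p (Φ (dropFirst a) b′)
    E-skip = 𝔼 n p (Φ (dropFirst a) bs)
    IH = potential (dropFirst a) (DegreeAtMost-dropFirst a a≤D)
    distribute : ∀ p ψ t s r → (p * (ψ * t) + (1ℚ - p) * s) * r ≡ p * ((ψ * r) * t) + (1ℚ - p) * (s * r)
    distribute = solve-∀ ℚ-ring
    collect : ∀ p c y → p * (c * y) + (1ℚ - p) * y ≡ (1ℚ - p + p * c) * y
    collect = solve-∀ ℚ-ring
    ψr≤ : ψ * r ≤ c * q ^ℚ ∣ b′ ∣
    ψr≤ = begin
      c * q ^ℚ D * r           ≡⟨ *-assoc c _ r ⟩
      c * (q ^ℚ D * r)         ≡⟨ cong (c *_) (^ℚ-+ q D ∣ bs ∣) ⟨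
      c * q ^ℚ (D ℕ.+ ∣ bs ∣)  ≤⟨ *-monoˡ-≤-0≤ 0≤c (^ℚ-antiʳ-≤ 0≤q q≤1 (∣b∪neighbours₀∣≤ a a≤D bs)) ⟩
      c * q ^ℚ ∣ b′ ∣          ∎
    take : (ψ * r) * E-take ≤ c * q ^ℚ n
    take = begin
      (ψ * r) * E-take            ≤⟨ *-monoʳ-≤-0≤ (0≤𝔼 _ 0≤p p≤1 (0≤Φ (dropFirst a) b′)) ψr≤ ⟩
      c * q ^ℚ ∣ b′ ∣ * E-take    ≡⟨ xy∙z≈x∙zy c (q ^ℚ ∣ b′ ∣) E-take ⟩
      c * (E-take * q ^ℚ ∣ b′ ∣)  ≤⟨ *-monoˡ-≤-0≤ 0≤c (IH b′) ⟩
      c * q ^ℚ n                  ∎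

  Pr-α≤-bound : ∀ {n} (H : Graph n) → DegreeAtMost (adj H) D → (E : Subset n → Bool) (N : ℕ) →
                (∀ A → E A ≡ true → α[ H ] A ℕ.≤ N) → Pr n p E * ψ ^ℚ N ≤ q ^ℚ n
  Pr-α≤-bound {n} H H≤D E N E⇒α≤N = begin
    Pr n p E * ψ ^ℚ N                  ≤⟨ markov E (ψ ^ℚ N) (Φ (adj H) ∅) 0≤p p≤1 (0≤Φ (adj H) ∅) ψ^N≤Φ ⟩
    𝔼 n p (Φ (adj H) ∅)                ≡⟨ *-identityʳ _ ⟨
    𝔼 n p (Φ (adj H) ∅) * q ^ℚ 0       ≡⟨ cong (λ k → 𝔼 n p (Φ (adj H) ∅) * q ^ℚ k) (∣⊥∣≡0 n) ⟨
    𝔼 n p (Φ (adj H) ∅) * q ^ℚ ∣ ∅ ∣   ≤⟨ potential (adj H) H≤D ∅ ⟩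
    q ^ℚ n                             ∎
    where
    open ≤-Reasoning
    ∅ : Subset n
    ∅ = ⊥
    ψ^N≤Φ : ∀ A → E A ≡ true → ψ ^ℚ N ≤ Φ (adj H) ∅ A
    ψ^N≤Φ A E[A] = ^ℚ-antiʳ-≤ 0≤ψ ψ≤1 (ℕₚ.≤-trans (greedy≤α H ∅ A) (E⇒α≤N A E[A]))

  q^[R+D]N≤ψ^N : ∀ R N → q ^ℚ R ≤ c → q ^ℚ ((R ℕ.+ D) ℕ.* N) ≤ ψ ^ℚ N
  q^[R+D]N≤ψ^N R N q^R≤c = begin
    q ^ℚ ((R ℕ.+ D) ℕ.* N)      ≡⟨ ^ℚ-* q (R ℕ.+ D) N ⟩
    (q ^ℚ (R ℕ.+ D)) ^ℚ N       ≡⟨ cong (_^ℚ N) (^ℚ-+ q R D) ⟩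
    (q ^ℚ R * q ^ℚ D) ^ℚ N      ≤⟨ ^ℚ-monoˡ-≤ N (0≤* (0≤^ℚ R 0≤q) (0≤^ℚ D 0≤q))
                                                 (*-monoʳ-≤-0≤ (0≤^ℚ D 0≤q) q^R≤c) ⟩
    ψ ^ℚ N                      ∎
    where open ≤-Reasoning

½ ¼ : ℚ
½ = ℤ.+ 1 / 2
¼ = ℤ.+ 1 / 4

0≤½ : 0ℚ ≤ ½
0≤½ = *≤* (ℤ.+≤+ ℕ.z≤n)

0≤¼ : 0ℚ ≤ ¼
0≤¼ = *≤* (ℤ.+≤+ ℕ.z≤n)

-- Here s = 1/d, ι = 1/κ, p = κ s and c = 1 - κ/4, so x = p (1 - c) is the gap 1 - q.
module ParameterArithmetic
  (κ d s ι : ℚ) (0≤κ : 0ℚ ≤ κ) (3κ≤1 : ℕ→ℚ 3 * κ ≤ 1ℚ) (0≤s : 0ℚ ≤ s)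
  (24s≤1 : ℕ→ℚ 24 * s ≤ 1ℚ) (ds≡1 : d * s ≡ 1ℚ) (κι≡1 : κ * ι ≡ 1ℚ)
  where

  κ≤1 : κ ≤ 1ℚ
  κ≤1 = ≤-by-slack (1ℚ - ℕ→ℚ 3 * κ + ℕ→ℚ 2 * κ) (0≤+ (p≤q⇒0≤q-p 3κ≤1) (0≤* (0≤ℕ→ℚ 2) 0≤κ))
    (solve (κ ∷ []) ℚ-ring)

  s≤1 : s ≤ 1ℚ
  s≤1 = ≤-by-slack (1ℚ - ℕ→ℚ 24 * s + ℕ→ℚ 23 * s) (0≤+ (p≤q⇒0≤q-p 24s≤1) (0≤* (0≤ℕ→ℚ 23) 0≤s))
    (solve (s ∷ []) ℚ-ring)

  0≤1-2κ : 0ℚ ≤ 1ℚ - ℕ→ℚ 2 * κ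
  0≤1-2κ = ≤-by-slack (1ℚ - ℕ→ℚ 3 * κ + κ) (0≤+ (p≤q⇒0≤q-p 3κ≤1) 0≤κ) (solve (κ ∷ []) ℚ-ring)

  0≤p : 0ℚ ≤ κ * s
  0≤p = 0≤* 0≤κ 0≤s

  p≤1 : κ * s ≤ 1ℚ
  p≤1 = *-≤1 0≤κ κ≤1 0≤s s≤1

  0<c : 0ℚ < 1ℚ - κ * ¼
  0<c = <-≤-trans (positive⁻¹ (ℤ.+ 3 / 4))
    (≤-by-slack (¼ * (1ℚ - κ)) (0≤* 0≤¼ (p≤q⇒0≤q-p κ≤1)) (solve (κ ∷ []) ℚ-ring))

  c≤1 : 1ℚ - κ * ¼ ≤ 1ℚ
  c≤1 = ≤-by-slack (κ * ¼) (0≤* 0≤κ 0≤¼) (solve (κ ∷ []) ℚ-ring)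

  x : ℚ
  x = κ * s * (1ℚ - (1ℚ - κ * ¼))

  0≤x : 0ℚ ≤ x
  0≤x = 0≤* 0≤p (≤-by-slack (κ * ¼) (0≤* 0≤κ 0≤¼) (solve (κ ∷ []) ℚ-ring))

  1≤c[1+Rx] : ∀ {R} → d * ι + d * ½ ≤ R → 1ℚ ≤ (1ℚ - κ * ¼) * (1ℚ + R * x)
  1≤c[1+Rx] {R} R̄≤R = begin
    1ℚ
      ≤⟨ ≤-by-slack (κ * κ * ¼ * ¼ * ½ * (1ℚ + (1ℚ - κ))) slack≥0 (solve (κ ∷ []) ℚ-ring) ⟩
    (1ℚ - κ * ¼) * (1ℚ + (κ * ¼ + κ * κ * ½ * ¼))
      ≡⟨ cong (λ u → (1ℚ - κ * ¼) * (1ℚ + u)) R̄x≡ ⟨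
    (1ℚ - κ * ¼) * (1ℚ + (d * ι + d * ½) * x)
      ≤⟨ *-monoˡ-≤-0≤ (<⇒≤ 0<c) (+-monoʳ-≤ 1ℚ (*-monoʳ-≤-0≤ 0≤x R̄≤R)) ⟩
    (1ℚ - κ * ¼) * (1ℚ + R * x) ∎
    where
    open ≤-Reasoning
    slack≥0 : 0ℚ ≤ κ * κ * ¼ * ¼ * ½ * (1ℚ + (1ℚ - κ))
    slack≥0 = 0≤* (0≤* (0≤* (0≤* (0≤* 0≤κ 0≤κ) 0≤¼) 0≤¼) 0≤½) (0≤+ 0≤1 (p≤q⇒0≤q-p κ≤1))
    R̄x≡ : (d * ι + d * ½) * (κ * s * (1ℚ - (1ℚ - κ * ¼))) ≡ κ * ¼ + κ * κ * ½ * ¼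
    R̄x≡ = begin-equality
      (d * ι + d * ½) * (κ * s * (1ℚ - (1ℚ - κ * ¼)))
        ≡⟨ solve (d ∷ s ∷ κ ∷ ι ∷ []) ℚ-ring ⟩
      (d * s) * (κ * ι) * (κ * ¼) + (d * s) * (κ * κ * ½ * ¼)
        ≡⟨ cong₂ (λ u v → u * v * (κ * ¼) + u * (κ * κ * ½ * ¼)) ds≡1 κι≡1 ⟩
      1ℚ * 1ℚ * (κ * ¼) + 1ℚ * (κ * κ * ½ * ¼)
        ≡⟨ solve (κ ∷ []) ℚ-ring ⟩
      κ * ¼ + κ * κ * ½ * ¼ ∎

  1≤½[1+Lx] : ∀ {L} → ℕ→ℚ 4 * d * ι * ι ≤ L → 1ℚ ≤ ½ * (1ℚ + L * x)
  1≤½[1+Lx] {L} L̄≤L = begin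
    1ℚ                                ≡⟨ refl ⟩
    ½ * (1ℚ + 1ℚ)                     ≡⟨ cong (λ u → ½ * (1ℚ + u)) L̄x≡1 ⟨
    ½ * (1ℚ + ℕ→ℚ 4 * d * ι * ι * x)  ≤⟨ *-monoˡ-≤-0≤ 0≤½ (+-monoʳ-≤ 1ℚ (*-monoʳ-≤-0≤ 0≤x L̄≤L)) ⟩
    ½ * (1ℚ + L * x)                  ∎
    where
    open ≤-Reasoning
    L̄x≡1 : ℕ→ℚ 4 * d * ι * ι * (κ * s * (1ℚ - (1ℚ - κ * ¼))) ≡ 1ℚ
    L̄x≡1 = begin-equality
      ℕ→ℚ 4 * d * ι * ι * (κ * s * (1ℚ - (1ℚ - κ * ¼)))  ≡⟨ solve (d ∷ s ∷ κ ∷ ι ∷ []) ℚ-ring ⟩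
      (d * s) * (κ * ι) * (κ * ι)                         ≡⟨ cong₂ (λ u v → u * v * v) ds≡1 κι≡1 ⟩
      1ℚ * 1ℚ * 1ℚ                                        ≡⟨ refl ⟩
      1ℚ                                                  ∎

  [R+D]p≤ : ∀ {R D} → R ≤ d * ι + d * ½ + 1ℚ → D ≤ (1ℚ + κ) * d →
            (R + D) * (κ * s) ≤ 1ℚ + κ * ½ + κ * s + (1ℚ + κ) * κ
  [R+D]p≤ {R} {D} R≤ D≤ = begin
    (R + D) * (κ * s)
      ≤⟨ *-monoʳ-≤-0≤ 0≤p (+-mono-≤ R≤ D≤) ⟩
    (d * ι + d * ½ + 1ℚ + (1ℚ + κ) * d) * (κ * s)
      ≡⟨ solve (d ∷ s ∷ κ ∷ ι ∷ []) ℚ-ring ⟩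
    (d * s) * (κ * ι) + (d * s) * (κ * ½) + κ * s + (1ℚ + κ) * κ * (d * s)
      ≡⟨ cong₂ (λ u v → u * v + u * (κ * ½) + κ * s + (1ℚ + κ) * κ * u) ds≡1 κι≡1 ⟩
    1ℚ * 1ℚ + 1ℚ * (κ * ½) + κ * s + (1ℚ + κ) * κ * 1ℚ
      ≡⟨ solve (κ ∷ s ∷ []) ℚ-ring ⟩
    1ℚ + κ * ½ + κ * s + (1ℚ + κ) * κ ∎
    where open ≤-Reasoning

  4[R+D]≤nκ : ∀ {R D T n} → R + D ≤ T → ℕ→ℚ 4 * ι * T ≤ n → ℕ→ℚ 4 * (R + D) ≤ n * κ
  4[R+D]≤nκ {R} {D} {T} {n} R+D≤T n₀≤n = begin
    ℕ→ℚ 4 * (R + D)            ≤⟨ *-monoˡ-≤-0≤ (0≤ℕ→ℚ 4) R+D≤T ⟩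
    ℕ→ℚ 4 * T                  ≡⟨ solve (T ∷ []) ℚ-ring ⟩
    ℕ→ℚ 4 * T * 1ℚ             ≡⟨ cong (ℕ→ℚ 4 * T *_) κι≡1 ⟨
    ℕ→ℚ 4 * T * (κ * ι)        ≡⟨ solve (T ∷ κ ∷ ι ∷ []) ℚ-ring ⟩
    ℕ→ℚ 4 * ι * T * κ          ≤⟨ *-monoʳ-≤-0≤ 0≤κ n₀≤n ⟩
    n * κ                      ∎
    where open ≤-Reasoning

  Lk≤ : ∀ {L k n} → 0ℚ ≤ L → 0ℚ ≤ k → 0ℚ ≤ n → L ≤ ℕ→ℚ 4 * d * ι * ι + 1ℚ → k ≤ κ ^ℚ 4 * n * s ^ℚ 5 →
        L * k ≤ ℕ→ℚ 5 * (κ * n * s)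
  Lk≤ {L} {k} {n} 0≤L 0≤k 0≤n L≤ k≤ = begin
    L * k
      ≤⟨ *-mono-≤-0≤ 0≤L 0≤k L≤ k≤ ⟩
    (ℕ→ℚ 4 * d * ι * ι + 1ℚ) * (κ * (κ * (κ * (κ * 1ℚ))) * n * (s * (s * (s * (s * (s * 1ℚ))))))
      ≡⟨ solve (κ ∷ d ∷ s ∷ ι ∷ n ∷ []) ℚ-ring ⟩
    κ * n * s * (ℕ→ℚ 4 * ((d * s) * (κ * ι) * (κ * ι)) * (κ * (s * (s * (s * 1ℚ))))
                   + κ * (κ * (κ * 1ℚ)) * (s * (s * (s * (s * 1ℚ)))))
      ≡⟨ cong₂ (λ u v → κ * n * s * (ℕ→ℚ 4 * (u * v * v) * κs³ + κ³s⁴)) ds≡1 κι≡1 ⟩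
    κ * n * s * (ℕ→ℚ 4 * (1ℚ * 1ℚ * 1ℚ) * κs³ + κ³s⁴)
      ≤⟨ *-monoˡ-≤-0≤ (0≤* (0≤* 0≤κ 0≤n) 0≤s)
           (+-mono-≤ (*-monoˡ-≤-0≤ (0≤ℕ→ℚ 4) (*-≤1 0≤κ κ≤1 (0≤^ℚ 3 0≤s) (^ℚ-≤1 3 0≤s s≤1)))
                     (*-≤1 (0≤^ℚ 3 0≤κ) (^ℚ-≤1 3 0≤κ κ≤1) (0≤^ℚ 4 0≤s) (^ℚ-≤1 4 0≤s s≤1))) ⟩
    κ * n * s * (ℕ→ℚ 4 * (1ℚ * 1ℚ * 1ℚ) * 1ℚ + 1ℚ)
      ≡⟨ solve (κ ∷ n ∷ s ∷ []) ℚ-ring ⟩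
    ℕ→ℚ 5 * (κ * n * s) ∎
    where
    open ≤-Reasoning
    κs³ κ³s⁴ : ℚ
    κs³ = κ * (s * (s * (s * 1ℚ)))
    κ³s⁴ = κ * (κ * (κ * 1ℚ)) * (s * (s * (s * (s * 1ℚ))))

  budget : ∀ {m N Lk n} → 0ℚ ≤ m → 0ℚ ≤ n →
           m * (κ * s) ≤ 1ℚ + κ * ½ + κ * s + (1ℚ + κ) * κ → ℕ→ℚ 4 * m ≤ n * κ →
           N ≤ (1ℚ - ℕ→ℚ 2 * κ) * n * (κ * s) + 1ℚ → Lk ≤ ℕ→ℚ 5 * (κ * n * s) →
           m * N + Lk ≤ n
  budget {m} {N} {Lk} {n} 0≤m 0≤n mp≤ 4m≤nκ N≤ Lk≤ = begin
    m * N + Lk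
      ≤⟨ +-mono-≤ (*-monoˡ-≤-0≤ 0≤m N≤) Lk≤ ⟩
    m * ((1ℚ - ℕ→ℚ 2 * κ) * n * (κ * s) + 1ℚ) + ℕ→ℚ 5 * (κ * n * s)
      ≡⟨ solve (m ∷ κ ∷ s ∷ n ∷ []) ℚ-ring ⟩
    (1ℚ - ℕ→ℚ 2 * κ) * n * (m * (κ * s)) + ¼ * (ℕ→ℚ 4 * m) + ℕ→ℚ 5 * (κ * n * s)
      ≤⟨ +-monoˡ-≤ _ (+-mono-≤ (*-monoˡ-≤-0≤ (0≤* 0≤1-2κ 0≤n) mp≤) (*-monoˡ-≤-0≤ 0≤¼ 4m≤nκ)) ⟩
    (1ℚ - ℕ→ℚ 2 * κ) * n * (1ℚ + κ * ½ + κ * s + (1ℚ + κ) * κ) + ¼ * (n * κ) + ℕ→ℚ 5 * (κ * n * s)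
      ≤⟨ ≤-by-slack (n * κ * (¼ * (1ℚ - ℕ→ℚ 24 * s) + ℕ→ℚ 2 * κ + ℕ→ℚ 2 * κ * s + ℕ→ℚ 2 * κ * κ))
                    slack≥0 (solve (κ ∷ s ∷ n ∷ []) ℚ-ring) ⟩
    n ∎
    where
    open ≤-Reasoning
    2κ≥0 : 0ℚ ≤ ℕ→ℚ 2 * κ
    2κ≥0 = 0≤* (0≤ℕ→ℚ 2) 0≤κ
    slack≥0 : 0ℚ ≤ n * κ * (¼ * (1ℚ - ℕ→ℚ 24 * s) + ℕ→ℚ 2 * κ + ℕ→ℚ 2 * κ * s + ℕ→ℚ 2 * κ * κ)
    slack≥0 = 0≤* (0≤* 0≤n 0≤κ)
      (0≤+ (0≤+ (0≤+ (0≤* 0≤¼ (p≤q⇒0≤q-p 24s≤1)) 2κ≥0) (0≤* 2κ≥0 0≤s)) (0≤* 2κ≥0 0≤κ))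

maxDegree : ∀ {n} → Graph n → ℕ
maxDegree {n} H = maxL (map (deg H) (allFin n))

degree≤maxDegree : ∀ {n} (H : Graph n) → DegreeAtMost (adj H) (maxDegree H)
degree≤maxDegree {n} H v = maxL-upper (map (deg H) (allFin n)) (∈-map⁺ (deg H) (∈-allFin v))

maxDegree≤ : ∀ {n B} (H : Graph n) → 0ℚ ≤ B → MaxDegLe H B → ℕ→ℚ (maxDegree H) ≤ B
maxDegree≤ {n} {B} H 0≤B Δ≤B = maxL-least (map (deg H) (allFin n)) 0≤B deg≤B
  where
  deg≤B : ∀ x → x ∈ map (deg H) (allFin n) → ℕ→ℚ x ≤ B
  deg≤B x x∈degs with ∈-map⁻ (deg H) x∈degs
  ... | v , _ , refl = ≤ᵇ⇒≤ (subst T (sym (Δ≤B v)) _)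

module ParameterChoice (κ : ℚ) (0<κ : 0ℚ < κ) (3κ<1 : ℕ→ℚ 3 * κ < 1ℚ)
                       (d : ℚ) (d>0 : Positive d) (24≤d : ℕ→ℚ 24 ≤ d) where

  s ι : ℚ
  s = inv⁺ d d>0
  ι = inv⁺ κ (positive 0<κ)

  0≤κ : 0ℚ ≤ κ
  0≤κ = <⇒≤ 0<κ

  0≤d : 0ℚ ≤ d
  0≤d = <⇒≤ (positive⁻¹ d {{d>0}})

  0≤s : 0ℚ ≤ s
  0≤s = <⇒≤ (positive⁻¹ s {{1/pos⇒pos d {{d>0}}}})

  0≤ι : 0ℚ ≤ ι
  0≤ι = <⇒≤ (positive⁻¹ ι {{1/pos⇒pos κ {{positive 0<κ}}}})

  ds≡1 : d * s ≡ 1ℚ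
  ds≡1 = *-inverseʳ d {{pos⇒nonZero d {{d>0}}}}

  24s≤1 : ℕ→ℚ 24 * s ≤ 1ℚ
  24s≤1 = ≤-trans (*-monoʳ-≤-0≤ 0≤s 24≤d) (≤-reflexive ds≡1)

  open ParameterArithmetic κ d s ι 0≤κ (<⇒≤ 3κ<1) 0≤s 24s≤1 ds≡1
    (*-inverseʳ κ {{pos⇒nonZero κ {{positive 0<κ}}}})
  open VertexWeight (κ * s) (1ℚ - κ * ¼) 0≤p p≤1 (<⇒≤ 0<c) c≤1

  R̄ L̄ m̄ : ℚ
  R̄ = d * ι + d * ½
  L̄ = ℕ→ℚ 4 * d * ι * ι
  m̄ = R̄ + 1ℚ + (1ℚ + κ) * d

  0≤1+κ : 0ℚ ≤ 1ℚ + κ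
  0≤1+κ = 0≤+ 0≤1 0≤κ

  0≤R̄ : 0ℚ ≤ R̄
  0≤R̄ = 0≤+ (0≤* 0≤d 0≤ι) (0≤* 0≤d 0≤½)

  0≤L̄ : 0ℚ ≤ L̄
  0≤L̄ = 0≤* (0≤* (0≤* (0≤ℕ→ℚ 4) 0≤d) 0≤ι) 0≤ι

  0≤4ιm̄ : 0ℚ ≤ ℕ→ℚ 4 * ι * m̄
  0≤4ιm̄ = 0≤* (0≤* (0≤ℕ→ℚ 4) 0≤ι) (0≤+ (0≤+ 0≤R̄ 0≤1) (0≤* 0≤1+κ 0≤d))

  R L n₀ : ℕ
  R  = proj₁ (ℕ-ceiling R̄ 0≤R̄)
  L  = proj₁ (ℕ-ceiling L̄ 0≤L̄)
  n₀ = proj₁ (ℕ-ceiling (ℕ→ℚ 4 * ι * m̄) 0≤4ιm̄)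

  q^R≤c : q ^ℚ R ≤ 1ℚ - κ * ¼
  q^R≤c = q^-bernoulli R (<⇒≤ 0<c) (1≤c[1+Rx] (proj₁ (proj₂ (ℕ-ceiling R̄ 0≤R̄))))

  q^L*2≤1 : q ^ℚ L * ℕ→ℚ 2 ≤ 1ℚ
  q^L*2≤1 = *-monoʳ-≤-0≤ (0≤ℕ→ℚ 2) (q^-bernoulli L 0≤½ (1≤½[1+Lx] (proj₁ (proj₂ (ℕ-ceiling L̄ 0≤L̄)))))

  threshold : ℕ → ℚ
  threshold n = (1ℚ - ℕ→ℚ 2 * κ) * ℕ→ℚ n * (κ * s)

  0≤threshold : ∀ n → 0ℚ ≤ threshold n
  0≤threshold n = 0≤* (0≤* 0≤1-2κ (0≤ℕ→ℚ n)) 0≤p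

  N : ℕ → ℕ
  N n = proj₁ (ℕ-ceiling (threshold n) (0≤threshold n))

  α≤threshold⇒α≤N : ∀ n {α} → ℕ→ℚ α ≤ threshold n → α ℕ.≤ N n
  α≤threshold⇒α≤N n α≤t =
    ℕ→ℚ-cancel-≤ (≤-trans α≤t (proj₁ (proj₂ (ℕ-ceiling (threshold n) (0≤threshold n)))))

  budgetℕ : ∀ {n D k} → n₀ ℕ.≤ n → ℕ→ℚ D ≤ (1ℚ + κ) * d → ℕ→ℚ k ≤ κ ^ℚ 4 * ℕ→ℚ n * s ^ℚ 5 →
            (R ℕ.+ D) ℕ.* N n ℕ.+ L ℕ.* k ℕ.≤ n
  budgetℕ {n} {D} {k} n₀≤n D≤ k≤ = ℕ→ℚ-cancel-≤ (subst (_≤ ℕ→ℚ n) (sym casts) budgetℚ)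
    where
    R≤ = proj₂ (proj₂ (ℕ-ceiling R̄ 0≤R̄))
    budgetℚ : (ℕ→ℚ R + ℕ→ℚ D) * ℕ→ℚ (N n) + ℕ→ℚ L * ℕ→ℚ k ≤ ℕ→ℚ n
    budgetℚ = budget (0≤+ (0≤ℕ→ℚ R) (0≤ℕ→ℚ D)) (0≤ℕ→ℚ n) ([R+D]p≤ R≤ D≤)
      (4[R+D]≤nκ {ℕ→ℚ R} {ℕ→ℚ D} (+-mono-≤ R≤ D≤)
        (≤-trans (proj₁ (proj₂ (ℕ-ceiling (ℕ→ℚ 4 * ι * m̄) 0≤4ιm̄))) (ℕ→ℚ-mono-≤ n₀≤n)))
      (proj₂ (proj₂ (ℕ-ceiling (threshold n) (0≤threshold n))))
      (Lk≤ (0≤ℕ→ℚ L) (0≤ℕ→ℚ k) (0≤ℕ→ℚ n) (proj₂ (proj₂ (ℕ-ceiling L̄ 0≤L̄))) k≤)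
    casts : ℕ→ℚ ((R ℕ.+ D) ℕ.* N n ℕ.+ L ℕ.* k) ≡ (ℕ→ℚ R + ℕ→ℚ D) * ℕ→ℚ (N n) + ℕ→ℚ L * ℕ→ℚ k
    casts = trans (ℕ→ℚ-+ ((R ℕ.+ D) ℕ.* N n) (L ℕ.* k))
      (cong₂ _+_ (trans (ℕ→ℚ-* (R ℕ.+ D) (N n)) (cong (_* ℕ→ℚ (N n)) (ℕ→ℚ-+ R D))) (ℕ→ℚ-* L k))

  tail-bound : ∀ n → n₀ ℕ.≤ n → (H : Graph n) → MaxDegLe H ((1ℚ + κ) * d) → (k : ℕ) →
               ℕ→ℚ k ≤ κ ^ℚ 4 * ℕ→ℚ n * s ^ℚ 5 →
               Pr n (κ * s) (λ A → ℕ→ℚ (α[ H ] A) ≤ᵇ threshold n) ^ℚ 1 * ℕ→ℚ 2 ^ℚ k ≤ 1ℚ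
  tail-bound n n₀≤n H Δ≤ k k≤ = begin
    Pr n (κ * s) E ^ℚ 1 * ℕ→ℚ 2 ^ℚ k  ≡⟨ cong (_* ℕ→ℚ 2 ^ℚ k) (*-identityʳ (Pr n (κ * s) E)) ⟩
    Pr n (κ * s) E * ℕ→ℚ 2 ^ℚ k       ≤⟨ *-monoʳ-≤-0≤ (0≤^ℚ k (0≤ℕ→ℚ 2)) Pr≤q^Lk ⟩
    q ^ℚ (L ℕ.* k) * ℕ→ℚ 2 ^ℚ k       ≡⟨ cong (_* ℕ→ℚ 2 ^ℚ k) (^ℚ-* q L k) ⟩
    (q ^ℚ L) ^ℚ k * ℕ→ℚ 2 ^ℚ k        ≤⟨ ^ℚ-halving k (0≤^ℚ L 0≤q) q^L*2≤1 ⟩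
    1ℚ                                ∎
    where
    open ≤-Reasoning
    D = maxDegree H
    open GreedyPotential (κ * s) (1ℚ - κ * ¼) D 0≤p p≤1 (<⇒≤ 0<c) c≤1
      using (Pr-α≤-bound; q^[R+D]N≤ψ^N)
    E : Subset n → Bool
    E A = ℕ→ℚ (α[ H ] A) ≤ᵇ threshold n
    E⇒α≤N : ∀ A → E A ≡ true → α[ H ] A ℕ.≤ N n
    E⇒α≤N A E[A] = α≤threshold⇒α≤N n (≤ᵇ⇒≤ (subst T (sym E[A]) _))
    Pr≤q^Lk : Pr n (κ * s) E ≤ q ^ℚ (L ℕ.* k)
    Pr≤q^Lk = ≤-pow-cancel ((R ℕ.+ D) ℕ.* N n) (L ℕ.* k) (<-≤-trans 0<c c≤q) q≤1
      (≤-trans (*-monoˡ-≤-0≤ (0≤Pr E 0≤p p≤1) (q^[R+D]N≤ψ^N R (N n) q^R≤c))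
               (Pr-α≤-bound H (degree≤maxDegree H) E (N n) E⇒α≤N))
      (budgetℕ n₀≤n (maxDegree≤ H (0≤* 0≤1+κ 0≤d) Δ≤) k≤)

lemma6p1 :
  Σ ℕ λ m → (1 ℕ.≤ m) ×
  ((κ : ℚ) → 0ℚ < κ → ℕ→ℚ 3 * κ < 1ℚ → (t : ℕ) →
    Σ ℕ λ d₀ → (d : ℚ) → (dpos : Positive d) → ℕ→ℚ d₀ ≤ d →
      Σ ℕ λ n₀ → (n : ℕ) → n₀ ℕ.≤ n →
        (H : Graph n) → KtttFree H t → HasAvgDeg H d →
        MaxDegLe H ((1ℚ + κ) * d) →
        (k : ℕ) →
        ℕ→ℚ k ≤ (κ ^ℚ 4) * ℕ→ℚ n * (inv⁺ d dpos ^ℚ 5) →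
        (Pr n (κ * inv⁺ d dpos)
           (λ A → ℕ→ℚ (α[ H ] A) ≤ᵇ (1ℚ - ℕ→ℚ 2 * κ) * ℕ→ℚ n * (κ * inv⁺ d dpos)))
          ^ℚ m * (ℕ→ℚ 2 ^ℚ k) ≤ 1ℚ)
lemma6p1 = 1 , ℕₚ.≤-refl , λ κ 0<κ 3κ<1 _ → 24 , λ d d>0 24≤d →
  let open ParameterChoice κ 0<κ 3κ<1 d d>0 24≤d in
  n₀ , λ n n₀≤n H _ _ Δ≤ k k≤ → tail-bound n n₀≤n H Δ≤ k k≤
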